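{- Let $T$ be a tournament and let $(X,Y)$ be a partition of $V(T)$ into two parts. Then $\overrightarrow{\omega}(T) \leq \overrightarrow{\omega}(T[X]) + \overrightarrow{\omega}(T[Y])$.
   Context: A tournament is a finite directed graph with exactly one arc between each pair of distinct vertices. For a total ordering $<$ of $V(T)$, the backedge graph $B(T,<)$ is the graph on $V(T)$ with an edge $uv$ for every pair $u<v$ with $vu \in A(T)$. The clique number of a tournament is $\overrightarrow{\omega}(T)=\min_{<}\omega(B(T,<))$ over all total orderings of $V(T)$ (with $\overrightarrow{\omega}$ of the empty tournament equal to $0$). -}

module Defs where

open import Level using (0ℓ)
open import Data.Bool using (Bool; true; false; not; T)
open import Data.Bool.Properties using (T-irrelevant)
open import Data.Nat using (ℕ; _≤_)
open import Data.Fin using (Fin)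
open import Data.Product using (Σ; ∃; _×_; _,_)
open import Data.Sum using (_⊎_)
open import Data.List using (List; length)
open import Data.List.Relation.Unary.AllPairs using (AllPairs)
open import Relation.Binary using (Rel; IsStrictTotalOrder)
open import Relation.Binary.PropositionalEquality using (_≡_; _≢_; refl; cong)

-- A tournament on vertex set V: a loopless digraph (arc u v = true means uv ∈ A(T))
-- with exactly one arc between each pair of distinct vertices.
record Tournament (V : Set) : Set where
  field
    arc      : V → V → Bool
    loopless : ∀ v → arc v v ≡ false
    oneArc   : ∀ u v → u ≢ v → arc u v ≡ not (arc v u)
open Tournament public

TotalOrder : Set → Set₁
TotalOrder V = Σ (Rel V 0ℓ) (IsStrictTotalOrder _≡_)

-- Backedge graph B(T,<): edge between u and v iff (u < v and vu ∈ A(T))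
-- (symmetrised, as it is an undirected graph).
BackEdge : {V : Set} → Tournament V → TotalOrder V → Rel V 0ℓ
BackEdge T (_<_ , _) u v =
  (u < v × arc T v u ≡ true) ⊎ (v < u × arc T u v ≡ true)

-- A clique of a graph with adjacency E: a list of vertices, pairwise adjacent
-- (hence pairwise distinct since E is irreflexive for backedge graphs).
IsClique : {V : Set} → Rel V 0ℓ → List V → Set
IsClique E xs = AllPairs E xs

IsCliqueNumber : {V : Set} → Rel V 0ℓ → ℕ → Set
IsCliqueNumber {V} E k =
  (∃ λ (xs : List V) → IsClique E xs × length xs ≡ k) ×
  (∀ (xs : List V) → IsClique E xs → length xs ≤ k)

IsTournamentCliqueNumber : {V : Set} → Tournament V → ℕ → Set₁
IsTournamentCliqueNumber T k =
  (∃ λ (o : TotalOrder _) → IsCliqueNumber (BackEdge T o) k) ×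
  (∀ (o : TotalOrder _) (w : ℕ) → IsCliqueNumber (BackEdge T o) w → k ≤ w)

Sub : {V : Set} → (V → Bool) → Set
Sub {V} X = Σ V (λ v → T (X v))

induced : {V : Set} → Tournament V → (X : V → Bool) → Tournament (Sub X)
induced {V} Tn X = record
  { arc      = λ u v → arc Tn (proj u) (proj v)
  ; loopless = λ v → loopless Tn (proj v)
  ; oneArc   = λ u v u≢v → oneArc Tn (proj u) (proj v) (λ e → u≢v (lift u v e))
  }
  where
  proj : Sub X → V
  proj (v , _) = v
  lift : ∀ (u v : Sub X) → proj u ≡ proj v → u ≡ v
  lift (u , p) (.u , q) refl = cong (u ,_) (T-irrelevant p q)

compl : {V : Set} → (V → Bool) → (V → Bool)
compl X v = not (X v)

-- Order T[X] optimally, order T[Y] optimally, and put all of X before all of Y.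
-- Every backedge of the concatenated order lies inside X or inside Y, so a clique of
-- its backedge graph splits into a clique of B(T[X]) and a clique of B(T[Y]).
-- Since Fin n is finite the backedge graph of this order has a clique number, which
-- bounds ω→(T) from above.
module Submission where

open import Defs
open import Level using (0ℓ)
open import Data.Bool using (Bool; true; false; not; T)
import Data.Bool.Properties as Bool
open import Data.Empty using (⊥; ⊥-elim)
open import Data.Fin using (Fin)
open import Data.Fin.Properties using (any?)
open import Data.List using (List; []; _∷_; length; map)
open import Data.List.Properties using (length-map)
open import Data.List.Relation.Unary.All using (All; []; _∷_)
open import Data.List.Relation.Unary.AllPairs as AllPairs using (AllPairs; []; _∷_; allPairs?)
import Data.List.Relation.Unary.AllPairs.Properties as AllPairs
open import Data.Nat using (ℕ; zero; suc; _≤_; _+_; z≤n)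
open import Data.Nat.Properties using (≤-refl; ≤-trans; ≤-pred; m≤n⇒m≤1+n; +-suc; +-mono-≤; ≤∧≢⇒<; module ≤-Reasoning)
open import Data.Product using (∃; _×_; _,_; proj₁)
import Data.Product as Product
open import Data.Sum using (_⊎_; inj₁; inj₂; [_,_])
import Data.Sum as Sum
open import Data.Sum.Relation.Binary.LeftOrder using (_⊎-<_; ⊎-<-isStrictTotalOrder; drop-inj₁; drop-inj₂)
open import Data.Sum.Relation.Binary.Pointwise using (Pointwise-≡⇒≡)
open import Function using (_on_)
open import Function.Definitions using (Injective)
import Relation.Binary.Construct.On as On
open import Relation.Binary using (Rel; _⇒_; IsStrictTotalOrder; Decidable; Tri; tri<; tri≈; tri>)
open import Relation.Binary.PropositionalEquality using (_≡_; refl; sym; trans; cong; subst₂; isEquivalence)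
open import Relation.Nullary using (Dec; yes; no)
open import Relation.Nullary.Decidable using (_×-dec_; _⊎-dec_)
import Relation.Unary as U

isStrictTotalOrder-≡ : {A : Set} {_≈_ _<_ : Rel A 0ℓ} → _≈_ ⇒ _≡_ →
                       IsStrictTotalOrder _≈_ _<_ → IsStrictTotalOrder _≡_ _<_
isStrictTotalOrder-≡ {_<_ = _<_} ≈⇒≡ sto = record
  { isStrictPartialOrder = record
    { isEquivalence = isEquivalence
    ; irrefl        = λ { refl → S.irrefl S.Eq.refl }
    ; trans         = S.trans
    ; <-resp-≈      = (λ { refl r → r }) , (λ { refl r → r })
    }
  ; compare = compare-≡
  }
  where
  module S = IsStrictTotalOrder sto
  compare-≡ : ∀ x y → Tri (x < y) (x ≡ y) (y < x)
  compare-≡ x y with S.compare x y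
  ... | tri< r ¬e ¬s = tri< r (λ { refl → ¬e S.Eq.refl }) ¬s
  ... | tri≈ ¬r e ¬s = tri≈ ¬r (≈⇒≡ e) ¬s
  ... | tri> ¬r ¬e s = tri> ¬r (λ { refl → ¬e S.Eq.refl }) s

⊎-totalOrder : {A B : Set} → TotalOrder A → TotalOrder B → TotalOrder (A ⊎ B)
⊎-totalOrder (_<ᴬ_ , stoᴬ) (_<ᴮ_ , stoᴮ) =
  (_<ᴬ_ ⊎-< _<ᴮ_) , isStrictTotalOrder-≡ Pointwise-≡⇒≡ (⊎-<-isStrictTotalOrder stoᴬ stoᴮ)

totalOrder-on : {A B : Set} (f : A → B) → Injective _≡_ _≡_ f → TotalOrder B → TotalOrder A
totalOrder-on f f-inj (_<_ , sto) = (_<_ on f) , isStrictTotalOrder-≡ f-inj (On.isStrictTotalOrder f sto)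

backEdge? : {V : Set} (Tn : Tournament V) (o : TotalOrder V) → Decidable (BackEdge Tn o)
backEdge? Tn (_ , sto) u v =
  (u <? v ×-dec arc Tn v u Bool.≟ true) ⊎-dec (v <? u ×-dec arc Tn u v Bool.≟ true)
  where open IsStrictTotalOrder sto using (_<?_)

module _ {n : ℕ} where

  ofLength? : {Q : List (Fin n) → Set} → U.Decidable Q →
              ∀ m → Dec (∃ λ xs → Q xs × length xs ≡ m)
  ofLength? Q? zero with Q? []
  ... | yes q = yes ([] , q , refl)
  ... | no ¬q = no λ { ([] , q , _) → ¬q q }
  ofLength? Q? (suc m) with any? (λ x → ofLength? (λ ys → Q? (x ∷ ys)) m)
  ... | yes (x , ys , q , refl) = yes (x ∷ ys , q , refl)
  ... | no ¬p = no λ { (x ∷ ys , q , refl) → ¬p (x , ys , q , refl) }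

  cliqueNumber-≤ : {E : Rel (Fin n) 0ℓ} → Decidable E → ∀ j →
                   (∀ xs → IsClique E xs → length xs ≤ j) →
                   ∃ λ w → IsCliqueNumber E w × w ≤ j
  cliqueNumber-≤ E? zero bound = zero , (([] , [] , refl) , bound) , z≤n
  cliqueNumber-≤ E? (suc j) bound with ofLength? (allPairs? E?) (suc j)
  ... | yes clique = suc j , (clique , bound) , ≤-refl
  ... | no ¬clique =
    let w , isCliqueNumber , w≤j = cliqueNumber-≤ E? j λ xs cl →
          ≤-pred (≤∧≢⇒< (bound xs cl) (λ e → ¬clique (xs , cl , e)))
    in w , isCliqueNumber , m≤n⇒m≤1+n w≤j

module _ {A B : Set} where

  lefts : List (A ⊎ B) → List A
  lefts [] = []
  lefts (inj₁ a ∷ zs) = a ∷ lefts zs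
  lefts (inj₂ _ ∷ zs) = lefts zs

  rights : List (A ⊎ B) → List B
  rights [] = []
  rights (inj₁ _ ∷ zs) = rights zs
  rights (inj₂ b ∷ zs) = b ∷ rights zs

  length-lefts+rights : ∀ zs → length (lefts zs) + length (rights zs) ≡ length zs
  length-lefts+rights [] = refl
  length-lefts+rights (inj₁ _ ∷ zs) = cong suc (length-lefts+rights zs)
  length-lefts+rights (inj₂ _ ∷ zs) = trans (+-suc _ _) (cong suc (length-lefts+rights zs))

  All-lefts : {P : A ⊎ B → Set} {zs : List (A ⊎ B)} → All P zs → All (λ a → P (inj₁ a)) (lefts zs)
  All-lefts {zs = []} [] = []
  All-lefts {zs = inj₁ _ ∷ _} (p ∷ ps) = p ∷ All-lefts ps
  All-lefts {zs = inj₂ _ ∷ _} (_ ∷ ps) = All-lefts ps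

  All-rights : {P : A ⊎ B → Set} {zs : List (A ⊎ B)} → All P zs → All (λ b → P (inj₂ b)) (rights zs)
  All-rights {zs = []} [] = []
  All-rights {zs = inj₁ _ ∷ _} (_ ∷ ps) = All-rights ps
  All-rights {zs = inj₂ _ ∷ _} (p ∷ ps) = p ∷ All-rights ps

  AllPairs-lefts : {R : Rel (A ⊎ B) 0ℓ} {zs : List (A ⊎ B)} → AllPairs R zs → AllPairs (R on inj₁) (lefts zs)
  AllPairs-lefts {zs = []} [] = []
  AllPairs-lefts {zs = inj₁ _ ∷ _} (p ∷ ps) = All-lefts p ∷ AllPairs-lefts ps
  AllPairs-lefts {zs = inj₂ _ ∷ _} (_ ∷ ps) = AllPairs-lefts ps

  AllPairs-rights : {R : Rel (A ⊎ B) 0ℓ} {zs : List (A ⊎ B)} → AllPairs R zs → AllPairs (R on inj₂) (rights zs)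
  AllPairs-rights {zs = []} [] = []
  AllPairs-rights {zs = inj₁ _ ∷ _} (_ ∷ ps) = AllPairs-rights ps
  AllPairs-rights {zs = inj₂ _ ∷ _} (p ∷ ps) = All-rights p ∷ AllPairs-rights ps

T-or-T-not : ∀ b → T b ⊎ T (not b)
T-or-T-not true = inj₁ _
T-or-T-not false = inj₂ _

T-and-T-not : ∀ {b} → T b → T (not b) → ⊥
T-and-T-not {true} _ ()

module Partition {V : Set} (X : V → Bool) where

  side : V → Sub X ⊎ Sub (compl X)
  side v = Sum.map (v ,_) (v ,_) (T-or-T-not (X v))

  forget : Sub X ⊎ Sub (compl X) → V
  forget = [ proj₁ , proj₁ ]

  forget-side : ∀ v → forget (side v) ≡ v
  forget-side v with T-or-T-not (X v)
  ... | inj₁ _ = refl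
  ... | inj₂ _ = refl

  side-injective : Injective _≡_ _≡_ side
  side-injective {u} {v} e = trans (sym (forget-side u)) (trans (cong forget e) (forget-side v))

  side-inX : (a : Sub X) → side (proj₁ a) ≡ inj₁ a
  side-inX (v , p) with T-or-T-not (X v)
  ... | inj₁ q = cong (λ r → inj₁ (v , r)) (Bool.T-irrelevant q p)
  ... | inj₂ q = ⊥-elim (T-and-T-not p q)

  side-inY : (a : Sub (compl X)) → side (proj₁ a) ≡ inj₂ a
  side-inY (v , p) with T-or-T-not (X v)
  ... | inj₁ q = ⊥-elim (T-and-T-not q p)
  ... | inj₂ q = cong (λ r → inj₂ (v , r)) (Bool.T-irrelevant q p)

module Concatenation {V : Set} (Tn : Tournament V) (X : V → Bool)
                     (oX : TotalOrder (Sub X)) (oY : TotalOrder (Sub (compl X))) where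

  open Partition X

  concatOrder : TotalOrder V
  concatOrder = totalOrder-on side side-injective (⊎-totalOrder oX oY)

  private
    _<_ : Rel V 0ℓ
    _<_ = proj₁ concatOrder

    _<ᶻ_ : Rel (Sub X ⊎ Sub (compl X)) 0ℓ
    _<ᶻ_ = proj₁ (⊎-totalOrder oX oY)

  <-inX : {a b : Sub X} → proj₁ a < proj₁ b → proj₁ oX a b
  <-inX {a} {b} a<b = drop-inj₁ (subst₂ _<ᶻ_ (side-inX a) (side-inX b) a<b)

  <-inY : {a b : Sub (compl X)} → proj₁ a < proj₁ b → proj₁ oY a b
  <-inY {a} {b} a<b = drop-inj₂ (subst₂ _<ᶻ_ (side-inY a) (side-inY b) a<b)

  backEdge-inX : {a b : Sub X} → BackEdge Tn concatOrder (proj₁ a) (proj₁ b) →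
                 BackEdge (induced Tn X) oX a b
  backEdge-inX = Sum.map (Product.map₁ <-inX) (Product.map₁ <-inX)

  backEdge-inY : {a b : Sub (compl X)} → BackEdge Tn concatOrder (proj₁ a) (proj₁ b) →
                 BackEdge (induced Tn (compl X)) oY a b
  backEdge-inY = Sum.map (Product.map₁ <-inY) (Product.map₁ <-inY)

  clique-≤ : {b c : ℕ} →
             (∀ ys → IsClique (BackEdge (induced Tn X) oX) ys → length ys ≤ b) →
             (∀ ys → IsClique (BackEdge (induced Tn (compl X)) oY) ys → length ys ≤ c) →
             ∀ xs → IsClique (BackEdge Tn concatOrder) xs → length xs ≤ b + c
  clique-≤ {b} {c} boundX boundY xs clique = begin
    length xs                              ≡⟨ length-map side xs ⟨
    length zs                              ≡⟨ length-lefts+rights zs ⟨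
    length (lefts zs) + length (rights zs) ≤⟨ +-mono-≤ (boundX _ cliqueX) (boundY _ cliqueY) ⟩
    b + c                                  ∎
    where
    open ≤-Reasoning
    zs : List (Sub X ⊎ Sub (compl X))
    zs = map side xs
    cliqueᶻ : AllPairs (BackEdge Tn concatOrder on forget) zs
    cliqueᶻ = AllPairs.map⁺ (AllPairs.map (λ {u} {v} →
      subst₂ (BackEdge Tn concatOrder) (sym (forget-side u)) (sym (forget-side v))) clique)
    cliqueX : IsClique (BackEdge (induced Tn X) oX) (lefts zs)
    cliqueX = AllPairs.map backEdge-inX (AllPairs-lefts cliqueᶻ)
    cliqueY : IsClique (BackEdge (induced Tn (compl X)) oY) (rights zs)
    cliqueY = AllPairs.map backEdge-inY (AllPairs-rights cliqueᶻ)

lemma1p1 : (n : ℕ) (Tn : Tournament (Fin n)) (X : Fin n → Bool) (a b c : ℕ) →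
           IsTournamentCliqueNumber Tn a →
           IsTournamentCliqueNumber (induced Tn X) b →
           IsTournamentCliqueNumber (induced Tn (compl X)) c →
           a ≤ b + c
lemma1p1 _ Tn X _ b c (_ , minimal) ((oX , _ , boundX) , _) ((oY , _ , boundY) , _) =
  let open Concatenation Tn X oX oY
      w , isCliqueNumber , w≤b+c =
        cliqueNumber-≤ (backEdge? Tn concatOrder) (b + c) (clique-≤ boundX boundY)
  in ≤-trans (minimal concatOrder w isCliqueNumber) w≤b+c
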